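{- For every $n\geq3$, $|P(T,n\times n)|=|P(S,n\times n)|$.
   Context: Let $\mathcal{A}=\{\mathtt{A},\dots,\mathtt{P}\}$, $\mathcal{B}=\{\mathtt{0},\mathtt{1},\mathtt{2},\mathtt{3}\}$. The substitution $\mu$ maps each letter to a $2\times2$ block over $\mathcal{A}$ (written (first row / second row)): $\mathtt{A}\mapsto(\mathtt{AF}/\mathtt{GC})$, $\mathtt{B}\mapsto(\mathtt{AF}/\mathtt{HD})$, $\mathtt{C}\mapsto(\mathtt{BE}/\mathtt{GC})$, $\mathtt{D}\mapsto(\mathtt{BE}/\mathtt{HD})$, $\mathtt{E}\mapsto(\mathtt{AN}/\mathtt{GK})$, $\mathtt{F}\mapsto(\mathtt{AN}/\mathtt{HL})$, $\mathtt{G}\mapsto(\mathtt{BM}/\mathtt{GK})$, $\mathtt{H}\mapsto(\mathtt{BM}/\mathtt{HL})$, $\mathtt{I}\mapsto(\mathtt{IF}/\mathtt{OC})$, $\mathtt{J}\mapsto(\mathtt{IF}/\mathtt{PD})$, $\mathtt{K}\mapsto(\mathtt{JE}/\mathtt{OC})$, $\mathtt{L}\mapsto(\mathtt{JE}/\mathtt{PD})$, $\mathtt{M}\mapsto(\mathtt{IN}/\mathtt{OK})$, $\mathtt{N}\mapsto(\mathtt{IN}/\mathtt{PL})$, $\mathtt{O}\mapsto(\mathtt{JM}/\mathtt{OK})$, $\mathtt{P}\mapsto(\mathtt{JM}/\mathtt{PL})$. The map $\phi$ from $\mathcal{A}$ to $2\times2$ blocks over $\mathcal{B}$: $\mathtt{A}\mapsto(01/00)$,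 $\mathtt{B}\mapsto(01/11)$, $\mathtt{C}\mapsto(10/00)$, $\mathtt{D}\mapsto(10/11)$, $\mathtt{E}\mapsto(03/02)$, $\mathtt{F}\mapsto(03/13)$, $\mathtt{G}\mapsto(12/02)$, $\mathtt{H}\mapsto(12/13)$, $\mathtt{I}\mapsto(21/20)$, $\mathtt{J}\mapsto(21/31)$, $\mathtt{K}\mapsto(30/20)$, $\mathtt{L}\mapsto(30/31)$, $\mathtt{M}\mapsto(23/22)$, $\mathtt{N}\mapsto(23/33)$, $\mathtt{O}\mapsto(32/22)$, $\mathtt{P}\mapsto(32/33)$. For a matrix $X$ over $\mathcal{A}$, $\mu(X)$ and $\phi(X)$ replace each entry by its $2\times 2$ block; $\mu^0=\mathrm{id}$, $\mu^k=\mu^{k-1}\circ\mu$; $T_k:=\mu^k(\mathtt{N})$. For a matrix $X$, $P(X,m\times n)$ is the set of all its $m\times n$ contiguous submatrices. Put $P(T,m\times n):=\bigcup_{k\ge0}P(T_k,m\times n)$ and $P(S,m\times n):=\bigcup_{k\ge0}P(\phi(T_k),m\times n)$. -}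

module Defs where

open import Data.Nat using (ℕ; zero; suc; _+_; _*_)
open import Data.Fin using (Fin; toℕ)
open import Data.Vec using (Vec; []; _∷_; map; concat; lookup)
open import Data.Maybe using (Maybe; just; nothing)
open import Data.Product using (Σ; ∃; _×_; _,_)
open import Data.List using (List; length)
open import Data.List.Membership.Propositional using (_∈_)
open import Data.List.Relation.Unary.Unique.Propositional using (Unique)
open import Function.Bundles using (_⇔_)
open import Relation.Binary.PropositionalEquality using (_≡_)

data 𝒜 : Set where
  A B C D E F G H I J K L M N O P : 𝒜

data ℬ : Set where
  b0 b1 b2 b3 : ℬ

Matrix : Set → ℕ → ℕ → Set
Matrix X m n = Vec (Vec X n) m

Block : Set → Set
Block X = Matrix X 2 2

blk : {X : Set} → X → X → X → X → Block X
blk a b c d = (a ∷ b ∷ []) ∷ (c ∷ d ∷ []) ∷ []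

blockSubst : {X Y : Set} {m n : ℕ} → (X → Block Y) → Matrix X m n → Matrix Y (m * 2) (n * 2)
blockSubst f rows = concat (map expandRow rows)
  where
  expandRow : _ → Vec _ 2
  expandRow r = concat (map (λ x → lookup (f x) Fin.zero) r)
              ∷ concat (map (λ x → lookup (f x) (Fin.suc Fin.zero)) r) ∷ []

μ₁ : 𝒜 → Block 𝒜
μ₁ A = blk A F G C
μ₁ B = blk A F H D
μ₁ C = blk B E G C
μ₁ D = blk B E H D
μ₁ E = blk A N G K
μ₁ F = blk A N H L
μ₁ G = blk B M G K
μ₁ H = blk B M H L
μ₁ I = blk I F O C
μ₁ J = blk I F P D
μ₁ K = blk J E O C
μ₁ L = blk J E P D
μ₁ M = blk I N O K
μ₁ N = blk I N P L
μ₁ O = blk J M O K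
μ₁ P = blk J M P L

φ₁ : 𝒜 → Block ℬ
φ₁ A = blk b0 b1 b0 b0
φ₁ B = blk b0 b1 b1 b1
φ₁ C = blk b1 b0 b0 b0
φ₁ D = blk b1 b0 b1 b1
φ₁ E = blk b0 b3 b0 b2
φ₁ F = blk b0 b3 b1 b3
φ₁ G = blk b1 b2 b0 b2
φ₁ H = blk b1 b2 b1 b3
φ₁ I = blk b2 b1 b2 b0
φ₁ J = blk b2 b1 b3 b1
φ₁ K = blk b3 b0 b2 b0
φ₁ L = blk b3 b0 b3 b1
φ₁ M = blk b2 b3 b2 b2
φ₁ N = blk b2 b3 b3 b3
φ₁ O = blk b3 b2 b2 b2
φ₁ P = blk b3 b2 b3 b3

μ : {m n : ℕ} → Matrix 𝒜 m n → Matrix 𝒜 (m * 2) (n * 2)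
μ = blockSubst μ₁

φ : {m n : ℕ} → Matrix 𝒜 m n → Matrix ℬ (m * 2) (n * 2)
φ = blockSubst φ₁

side : ℕ → ℕ
side zero = 1
side (suc k) = side k * 2

T : (k : ℕ) → Matrix 𝒜 (side k) (side k)
T zero = (N ∷ []) ∷ []
T (suc k) = μ (T k)

lookupℕ : {X : Set} {n : ℕ} → Vec X n → ℕ → Maybe X
lookupℕ [] _ = nothing
lookupℕ (x ∷ xs) zero = just x
lookupℕ (x ∷ xs) (suc i) = lookupℕ xs i

entry : {X : Set} {p q : ℕ} → Matrix X p q → ℕ → ℕ → Maybe X
entry Z i j with lookupℕ Z i
... | just row = lookupℕ row j
... | nothing = nothing

IsSubmatrix : {X : Set} {m n p q : ℕ} → Matrix X m n → Matrix X p q → Set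
IsSubmatrix {m = m} {n} Y Z =
  Σ ℕ λ i → Σ ℕ λ j → (a : Fin m) (b : Fin n) →
    entry Z (i + toℕ a) (j + toℕ b) ≡ just (lookup (lookup Y a) b)

InPT : {m n : ℕ} → Matrix 𝒜 m n → Set
InPT Y = Σ ℕ λ k → IsSubmatrix Y (T k)

InPS : {m n : ℕ} → Matrix ℬ m n → Set
InPS Y = Σ ℕ λ k → IsSubmatrix Y (φ (T k))

HasSize : {X : Set} → (X → Set) → ℕ → Set
HasSize {X} Q c = Σ (List X) λ xs → Unique xs × length xs ≡ c × ((x : X) → (x ∈ xs) ⇔ Q x)

module Submission where

-- There is π : 𝒜 → ℬ with φ₁ = π ∘ μ₁ entrywise, so φ(T_k) is the letterwise π-image of T_{k+1};
-- and a letter of T_{k+1} is determined by its π-image together with the parities of its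
-- position (the quadrant of its μ-block).
--
-- The 2×2 blocks occurring in the T_k are the 76 blocks of T₅: the block of T₁ is one of them,
-- and the children of each are again among them. A window of size at most 2^m of any T_k lies
-- in μ^m of such a block, hence already occurs in T_{m+5}; so P(T, n×n) is the finite set of
-- n×n windows of T_{n+5}.
--
-- The π-image of a 3×2 window of T determines the parities of its position (checked over all
-- 3×2 windows), so for n ≥ 3 the π-image of an n×n window determines the window, and π maps
-- P(T, n×n) bijectively onto P(S, n×n).

open import Defs
open import Data.Nat
  using (ℕ; zero; suc; _+_; _*_; _∸_; _≤_; _<_; z≤n; s≤s; _<?_; ⌊_/2⌋; _/_; _%_; NonZero; >-nonZero)
open import Data.Nat.Properties
open import Data.Nat.DivMod using (m≡m%n+[m/n]*n; m%n<n)
open import Data.Nat.Tactic.RingSolver using (solve-∀)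
open import Data.Fin as Fin using (Fin; toℕ; fromℕ; fromℕ<)
open import Data.Fin.Patterns using (0F; 1F)
import Data.Fin.Properties as Fin
open import Data.Vec as Vec using (Vec; []; _∷_; lookup; tabulate; concat)
import Data.Vec.Properties as Vec
open import Data.Maybe as Maybe using (just; nothing; _>>=_)
open import Data.List as List using (List; upTo; cartesianProductWith; deduplicate; length)
open import Data.List.Properties using (length-map)
open import Data.List.Membership.Propositional using (_∈_)
open import Data.List.Membership.Propositional.Properties
  using ( ∈-map⁺; ∈-map⁻; ∈-upTo⁺; ∈-upTo⁻; ∈-cartesianProductWith⁺; ∈-cartesianProductWith⁻
        ; ∈-deduplicate⁺; ∈-deduplicate⁻)
open import Data.List.Relation.Unary.Any using (here; there)
import Data.List.Relation.Unary.All as All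
import Data.List.Relation.Unary.All.Properties as All
open import Data.List.Relation.Unary.AllPairs using ([]; _∷_)
open import Data.List.Relation.Unary.Unique.Propositional using (Unique)
open import Data.List.Relation.Unary.Unique.DecPropositional.Properties using (deduplicate-!)
open import Data.Product using (Σ; _×_; _,_; proj₁; proj₂)
import Data.Product.Properties as Product
open import Function.Bundles using (_⇔_; mk⇔; Equivalence)
open import Relation.Binary.Definitions using (DecidableEquality)
open import Relation.Binary.PropositionalEquality hiding (J)
open import Relation.Nullary using (Dec; yes; no; contradiction)
open import Relation.Nullary.Decidable using (map′; from-yes; _×-dec_)

-- Grids and block substitutions

Grid : Set → Set
Grid X = ℕ → ℕ → X

lookup² : ∀ {X h w} → Matrix X h w → Fin h → Fin w → X
lookup² Z a b = lookup (lookup Z a) b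

parity : ℕ → Fin 2
parity 0 = 0F
parity 1 = 1F
parity (suc (suc n)) = parity n

⌊m*2+n/2⌋≡m+⌊n/2⌋ : ∀ m n → ⌊ m * 2 + n /2⌋ ≡ m + ⌊ n /2⌋
⌊m*2+n/2⌋≡m+⌊n/2⌋ zero n = refl
⌊m*2+n/2⌋≡m+⌊n/2⌋ (suc m) n = cong suc (⌊m*2+n/2⌋≡m+⌊n/2⌋ m n)

parity-*2+ : ∀ m n → parity (m * 2 + n) ≡ parity n
parity-*2+ zero n = refl
parity-*2+ (suc m) n = parity-*2+ m n

parity-+ˡ : ∀ x a → parity (x + a) ≡ parity (toℕ (parity x) + a)
parity-+ˡ 0 a = refl
parity-+ˡ 1 a = refl
parity-+ˡ (suc (suc x)) a = parity-+ˡ x a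

parity-cong-+ : ∀ {x x′} → parity x ≡ parity x′ → ∀ a → parity (x + a) ≡ parity (x′ + a)
parity-cong-+ {x} {x′} eq a =
  trans (parity-+ˡ x a) (trans (cong (λ p → parity (toℕ p + a)) eq) (sym (parity-+ˡ x′ a)))

n<m*2⇒⌊n/2⌋<m : ∀ {m n} → n < m * 2 → ⌊ n /2⌋ < m
n<m*2⇒⌊n/2⌋<m {suc m} {0} _ = s≤s z≤n
n<m*2⇒⌊n/2⌋<m {suc m} {1} _ = s≤s z≤n
n<m*2⇒⌊n/2⌋<m {suc m} {suc (suc n)} (s≤s (s≤s n<)) = s≤s (n<m*2⇒⌊n/2⌋<m n<)

⌊n/2⌋<m⇒n<m*2 : ∀ {m n} → ⌊ n /2⌋ < m → n < m * 2
⌊n/2⌋<m⇒n<m*2 {suc m} {0} _ = s≤s z≤n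
⌊n/2⌋<m⇒n<m*2 {suc m} {1} _ = s≤s (s≤s z≤n)
⌊n/2⌋<m⇒n<m*2 {suc m} {suc (suc n)} (s≤s n<) = s≤s (s≤s (⌊n/2⌋<m⇒n<m*2 n<))

module _ {X : Set} where

  record Agree (h w : ℕ) (f : Grid X) (x y : ℕ) (g : Grid X) (x′ y′ : ℕ) : Set where
    constructor agree
    field
      at : ∀ {a} → a < h → ∀ {b} → b < w → f (x + a) (y + b) ≡ g (x′ + a) (y′ + b)

  open Agree public

  Agree-trans : ∀ {h w f x y g x′ y′ k x″ y″} →
    Agree h w f x y g x′ y′ → Agree h w g x′ y′ k x″ y″ → Agree h w f x y k x″ y″
  Agree-trans fg gk = agree λ a< b< → trans (at fg a< b<) (at gk a< b<)

  Agree-restrict : ∀ {h w h₁ w₁ f x y g x′ y′} → h₁ ≤ h → w₁ ≤ w →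
    Agree h w f x y g x′ y′ → Agree h₁ w₁ f x y g x′ y′
  Agree-restrict h₁≤h w₁≤w fg = agree λ a< b< → at fg (<-≤-trans a< h₁≤h) (<-≤-trans b< w₁≤w)

  Agree-shrink : ∀ {h w f x y g x′ y′ h₁ w₁} e d → e + h₁ ≤ h → d + w₁ ≤ w →
    Agree h w f x y g x′ y′ → Agree h₁ w₁ f (x + e) (y + d) g (x′ + e) (y′ + d)
  Agree-shrink {f = f} {x} {y} {g} {x′} {y′} {h₁} {w₁} e d e+h₁≤h d+w₁≤w fg = agree shrunk
    where
    shrunk : ∀ {a} → a < h₁ → ∀ {b} → b < w₁ → f (x + e + a) (y + d + b) ≡ g (x′ + e + a) (y′ + d + b)
    shrunk {a} a< {b} b<
      rewrite +-assoc x e a | +-assoc y d b | +-assoc x′ e a | +-assoc y′ d b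
      = at fg (<-≤-trans (+-monoʳ-< e a<) e+h₁≤h) (<-≤-trans (+-monoʳ-< d b<) d+w₁≤w)

  Agree-corner : ∀ {h w f x y g x′ y′} → 0 < h → 0 < w → Agree h w f x y g x′ y′ → f x y ≡ g x′ y′
  Agree-corner {f = f} {x} {y} {g} {x′} {y′} 0<h 0<w fg =
    subst₂ (λ a b → f a b ≡ g x′ y′) (+-identityʳ x) (+-identityʳ y)
      (subst₂ (λ a b → f (x + 0) (y + 0) ≡ g a b) (+-identityʳ x′) (+-identityʳ y′) (at fg 0<h 0<w))

  agree? : DecidableEquality X → ∀ h w f x y g x′ y′ → Dec (Agree h w f x y g x′ y′)
  agree? _≟_ h w f x y g x′ y′ =
    map′ agree at (allUpTo? (λ a → allUpTo? (λ b → f (x + a) (y + b) ≟ g (x′ + a) (y′ + b)) w) h)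

Agree-map : {X Y : Set} (u : X → Y) → ∀ {h w f x y g x′ y′} → Agree h w f x y g x′ y′ →
  Agree h w (λ i j → u (f i j)) x y (λ i j → u (g i j)) x′ y′
Agree-map u fg = agree λ a< b< → cong u (at fg a< b<)

module _ {X : Set} (σ : X → Block X) where

  expand : Grid X → Grid X
  expand f i j = lookup² (σ (f ⌊ i /2⌋ ⌊ j /2⌋)) (parity i) (parity j)

  expand^ : ℕ → Grid X → Grid X
  expand^ zero f = f
  expand^ (suc k) f = expand (expand^ k f)

  expand^-+ : ∀ m k f → expand^ (m + k) f ≡ expand^ m (expand^ k f)
  expand^-+ zero k f = refl
  expand^-+ (suc m) k f = cong expand (expand^-+ m k f)

  expand-*2+ : ∀ f x y a b →
    expand f (x * 2 + a) (y * 2 + b) ≡ lookup² (σ (f (x + ⌊ a /2⌋) (y + ⌊ b /2⌋))) (parity a) (parity b)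
  expand-*2+ f x y a b
    rewrite ⌊m*2+n/2⌋≡m+⌊n/2⌋ x a | ⌊m*2+n/2⌋≡m+⌊n/2⌋ y b | parity-*2+ x a | parity-*2+ y b = refl

  expand-agree : ∀ {h w f x y g x′ y′} → Agree h w f x y g x′ y′ →
    Agree (h * 2) (w * 2) (expand f) (x * 2) (y * 2) (expand g) (x′ * 2) (y′ * 2)
  expand-agree {f = f} {x} {y} {g} {x′} {y′} fg = agree λ {a} a< {b} b< → begin
    expand f (x * 2 + a) (y * 2 + b)
      ≡⟨ expand-*2+ f x y a b ⟩
    lookup² (σ (f (x + ⌊ a /2⌋) (y + ⌊ b /2⌋))) (parity a) (parity b)
      ≡⟨ cong (λ z → lookup² (σ z) (parity a) (parity b))
              (at fg (n<m*2⇒⌊n/2⌋<m a<) (n<m*2⇒⌊n/2⌋<m b<)) ⟩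
    lookup² (σ (g (x′ + ⌊ a /2⌋) (y′ + ⌊ b /2⌋))) (parity a) (parity b)
      ≡⟨ expand-*2+ g x′ y′ a b ⟨
    expand g (x′ * 2 + a) (y′ * 2 + b) ∎
    where open ≡-Reasoning

  expand^-agree : ∀ m {h w f x y g x′ y′} → Agree h w f x y g x′ y′ →
    Agree (h * side m) (w * side m) (expand^ m f) (x * side m) (y * side m) (expand^ m g) (x′ * side m) (y′ * side m)
  expand^-agree zero {h} {w} {x = x} {y} {x′ = x′} {y′} fg
    rewrite *-identityʳ h | *-identityʳ w | *-identityʳ x | *-identityʳ y | *-identityʳ x′ | *-identityʳ y′ = fg
  expand^-agree (suc m) {h} {w} {x = x} {y} {x′ = x′} {y′} fg
    rewrite sym (*-assoc h (side m) 2) | sym (*-assoc w (side m) 2) | sym (*-assoc x (side m) 2)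
          | sym (*-assoc y (side m) 2) | sym (*-assoc x′ (side m) 2) | sym (*-assoc y′ (side m) 2)
    = expand-agree (expand^-agree m fg)

side-+ : ∀ m k → side (m + k) ≡ side k * side m
side-+ zero k = sym (*-identityʳ (side k))
side-+ (suc m) k = trans (cong (_* 2) (side-+ m k)) (*-assoc (side k) (side m) 2)

1≤side : ∀ m → 1 ≤ side m
1≤side zero = s≤s z≤n
1≤side (suc m) = ≤-trans (1≤side m) (m≤m*n (side m) 2)

2≤side : ∀ k → 2 ≤ side (suc k)
2≤side k = *-monoˡ-≤ 2 (1≤side k)

m+m≡2*m : ∀ m → m + m ≡ 2 * m
m+m≡2*m m = cong (m +_) (sym (+-identityʳ m))

n<side : ∀ n → n < side n
n<side zero = s≤s z≤n
n<side (suc n) = begin-strict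
  suc n            ≤⟨ n<side n ⟩
  side n           <⟨ m<m+n (side n) (1≤side n) ⟩
  side n + side n  ≡⟨ trans (m+m≡2*m (side n)) (*-comm 2 (side n)) ⟩
  side n * 2       ∎
  where open ≤-Reasoning

-- The last block row has no successor, so a window starting there is assigned to the row above.
split-index : ∀ s S {h x} → 0 < h → h ≤ s → 2 ≤ S → x + h ≤ S * s →
  Σ ℕ λ p → Σ ℕ λ r → suc p < S × r + h ≤ 2 * s × x ≡ p * s + r
split-index s S {h} {x} 0<h h≤s 2≤S x+h≤S*s = divide {{>-nonZero (<-≤-trans 0<h h≤s)}}
  where
  Split : Set
  Split = Σ ℕ λ p → Σ ℕ λ r → suc p < S × r + h ≤ 2 * s × x ≡ p * s + r

  p<S : ∀ p r → x ≡ p * s + r → p < S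
  p<S p r refl = *-cancelʳ-< s p S (begin-strict
    p * s            ≤⟨ m≤m+n (p * s) r ⟩
    p * s + r        <⟨ m<m+n (p * s + r) 0<h ⟩
    p * s + r + h    ≤⟨ x+h≤S*s ⟩
    S * s            ∎)
    where open ≤-Reasoning

  borrow : ∀ p r → x ≡ suc p * s + r → S ≤ suc (suc p) → Split
  borrow p r x≡ S≤2+p = p , r + s , p<S (suc p) r x≡ , r+s+h≤ , trans x≡ (shift s p r)
    where
    shift : ∀ s p r → suc p * s + r ≡ p * s + (r + s)
    shift = solve-∀
    r+h≤s : r + h ≤ s
    r+h≤s = +-cancelˡ-≤ (suc p * s) (r + h) s (begin
      suc p * s + (r + h)  ≡⟨ +-assoc (suc p * s) r h ⟨
      suc p * s + r + h    ≡⟨ cong (_+ h) x≡ ⟨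
      x + h                ≤⟨ x+h≤S*s ⟩
      S * s                ≤⟨ *-monoˡ-≤ s S≤2+p ⟩
      s + suc p * s        ≡⟨ +-comm s (suc p * s) ⟩
      suc p * s + s        ∎)
      where open ≤-Reasoning
    r+s+h≤ : r + s + h ≤ 2 * s
    r+s+h≤ = begin
      r + s + h    ≡⟨ +-assoc r s h ⟩
      r + (s + h)  ≡⟨ cong (r +_) (+-comm s h) ⟩
      r + (h + s)  ≡⟨ +-assoc r h s ⟨
      r + h + s    ≤⟨ +-monoˡ-≤ s r+h≤s ⟩
      s + s        ≡⟨ m+m≡2*m s ⟩
      2 * s        ∎
      where open ≤-Reasoning

  place : ∀ p r → x ≡ p * s + r → r < s → Split
  place p r x≡ r<s with suc p <? S
  ... | yes 1+p<S = p , r , 1+p<S , subst (r + h ≤_) (m+m≡2*m s) (+-mono-≤ (<⇒≤ r<s) h≤s) , x≡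
  place zero r x≡ r<s | no 1+p≮S = contradiction (≤-trans 2≤S (≮⇒≥ 1+p≮S)) λ { (s≤s ()) }
  place (suc p) r x≡ r<s | no 1+p≮S = borrow p r x≡ (≮⇒≥ 1+p≮S)

  divide : .{{NonZero s}} → Split
  divide = place (x / s) (x % s) (trans (m≡m%n+[m/n]*n x s) (+-comm (x % s) (x / s * s))) (m%n<n x s)

entry≡lookup>>=lookup : ∀ {X p q} (Z : Matrix X p q) i j →
  entry Z i j ≡ (lookupℕ Z i >>= λ row → lookupℕ row j)
entry≡lookup>>=lookup Z i j with lookupℕ Z i
... | just row = refl
... | nothing = refl

lookupℕ-concat-map : ∀ {X Y q} (g : X → Vec Y 2) (r : Vec X q) j →
  lookupℕ (concat (Vec.map g r)) j ≡ Maybe.map (λ x → lookup (g x) (parity j)) (lookupℕ r ⌊ j /2⌋)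
lookupℕ-concat-map g [] j = refl
lookupℕ-concat-map g (x ∷ r) 0 with g x
... | _ ∷ _ ∷ [] = refl
lookupℕ-concat-map g (x ∷ r) 1 with g x
... | _ ∷ _ ∷ [] = refl
lookupℕ-concat-map g (x ∷ r) (suc (suc j)) with g x
... | _ ∷ _ ∷ [] = lookupℕ-concat-map g r j

entry-blockSubst : ∀ {X Y p q} (σ : X → Block Y) (Z : Matrix X p q) i j →
  entry (blockSubst σ Z) i j
    ≡ Maybe.map (λ x → lookup² (σ x) (parity i) (parity j)) (entry Z ⌊ i /2⌋ ⌊ j /2⌋)
entry-blockSubst {X} {Y} {p} {q} σ Z i j = begin
  entry (blockSubst σ Z) i j
    ≡⟨ entry≡lookup>>=lookup (blockSubst σ Z) i j ⟩
  (lookupℕ (blockSubst σ Z) i >>= λ row → lookupℕ row j)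
    ≡⟨ rows Z i ⟩
  Maybe.map (λ x → lookup² (σ x) (parity i) (parity j))
            (lookupℕ Z ⌊ i /2⌋ >>= λ row → lookupℕ row ⌊ j /2⌋)
    ≡⟨ cong (Maybe.map _) (entry≡lookup>>=lookup Z ⌊ i /2⌋ ⌊ j /2⌋) ⟨
  Maybe.map (λ x → lookup² (σ x) (parity i) (parity j)) (entry Z ⌊ i /2⌋ ⌊ j /2⌋) ∎
  where
  open ≡-Reasoning
  rows : ∀ {p′} (Z : Matrix X p′ q) i →
    (lookupℕ (blockSubst σ Z) i >>= λ row → lookupℕ row j)
      ≡ Maybe.map (λ x → lookup² (σ x) (parity i) (parity j))
                  (lookupℕ Z ⌊ i /2⌋ >>= λ row → lookupℕ row ⌊ j /2⌋)
  rows [] i = refl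
  rows (r ∷ Z) 0 = lookupℕ-concat-map (λ x → lookup (σ x) 0F) r j
  rows (r ∷ Z) 1 = lookupℕ-concat-map (λ x → lookup (σ x) 1F) r j
  rows (r ∷ Z) (suc (suc i)) = rows Z i

-- Outside the square [0, side k)² the values are junk.
T-at : ℕ → Grid 𝒜
T-at k = expand^ μ₁ k (λ _ _ → N)

entry-T : ∀ k {i j} → i < side k → j < side k → entry (T k) i j ≡ just (T-at k i j)
entry-T zero {0} {0} _ _ = refl
entry-T zero {suc i} (s≤s ())
entry-T zero {0} {suc j} _ (s≤s ())
entry-T (suc k) {i} {j} i< j<
  rewrite entry-blockSubst μ₁ (T k) i j | entry-T k (n<m*2⇒⌊n/2⌋<m i<) (n<m*2⇒⌊n/2⌋<m j<) = refl

entry-T⁻ : ∀ k {i j z} → entry (T k) i j ≡ just z → i < side k × j < side k × z ≡ T-at k i j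
entry-T⁻ zero {0} {0} refl = s≤s z≤n , s≤s z≤n , refl
entry-T⁻ zero {0} {suc j} ()
entry-T⁻ zero {suc i} ()
entry-T⁻ (suc k) {i} {j} e
  rewrite entry-blockSubst μ₁ (T k) i j with entry (T k) ⌊ i /2⌋ ⌊ j /2⌋ in parent | e
... | just x | refl with entry-T⁻ k parent
... | i< , j< , refl = ⌊n/2⌋<m⇒n<m*2 i< , ⌊n/2⌋<m⇒n<m*2 j< , refl

window : ∀ {X : Set} h w → Grid X → ℕ → ℕ → Matrix X h w
window h w f x y = tabulate λ a → tabulate λ b → f (x + toℕ a) (y + toℕ b)

lookup²-window : ∀ {X h w} (f : Grid X) x y a b → lookup² (window h w f x y) a b ≡ f (x + toℕ a) (y + toℕ b)
lookup²-window f x y a b = trans (cong (λ row → lookup row b) (Vec.lookup∘tabulate _ a)) (Vec.lookup∘tabulate _ b)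

vec-ext : ∀ {X : Set} {n} {u v : Vec X n} → (∀ a → lookup u a ≡ lookup v a) → u ≡ v
vec-ext {u = u} {v} u≗v = trans (sym (Vec.tabulate∘lookup u)) (trans (Vec.tabulate-cong u≗v) (Vec.tabulate∘lookup v))

matrix-ext : ∀ {X h w} {Z Z′ : Matrix X h w} → (∀ a b → lookup² Z a b ≡ lookup² Z′ a b) → Z ≡ Z′
matrix-ext Z≗Z′ = vec-ext λ a → vec-ext (Z≗Z′ a)

mapᴹ : ∀ {X Y h w} → (X → Y) → Matrix X h w → Matrix Y h w
mapᴹ u = Vec.map (Vec.map u)

lookup²-mapᴹ : ∀ {X Y h w} (u : X → Y) (Z : Matrix X h w) a b → lookup² (mapᴹ u Z) a b ≡ u (lookup² Z a b)
lookup²-mapᴹ u Z a b =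
  trans (cong (λ row → lookup row b) (Vec.lookup-map a (Vec.map u) Z)) (Vec.lookup-map b u (lookup Z a))

mapᴹ-window : ∀ {X Y h w} (u : X → Y) (f : Grid X) x y →
  mapᴹ u (window h w f x y) ≡ window h w (λ i j → u (f i j)) x y
mapᴹ-window {h = h} {w} u f x y = matrix-ext λ a b →
  trans (lookup²-mapᴹ u (window h w f x y) a b)
        (trans (cong u (lookup²-window f x y a b)) (sym (lookup²-window (λ i j → u (f i j)) x y a b)))

window-cong : ∀ {X h w} {f g : Grid X} {x y x′ y′} →
  Agree h w f x y g x′ y′ → window h w f x y ≡ window h w g x′ y′
window-cong fg = Vec.tabulate-cong λ a → Vec.tabulate-cong λ b → at fg (Fin.toℕ<n a) (Fin.toℕ<n b)

window-agree : ∀ {X h w} {f g : Grid X} {x y x′ y′} →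
  window h w f x y ≡ window h w g x′ y′ → Agree h w f x y g x′ y′
window-agree {f = f} {g} {x} {y} {x′} {y′} eq = agree λ {a} a< {b} b< →
  subst₂ (λ a b → f (x + a) (y + b) ≡ g (x′ + a) (y′ + b)) (Fin.toℕ-fromℕ< a<) (Fin.toℕ-fromℕ< b<)
    (trans (sym (lookup²-window f x y _ _))
           (trans (cong (λ Z → lookup² Z (fromℕ< a<) (fromℕ< b<)) eq) (lookup²-window g x′ y′ _ _)))

record Represents {X : Set} {p q} (Z : Matrix X p q) (s : ℕ) (g : Grid X) : Set where
  field
    entry-inside : ∀ {i j} → i < s → j < s → entry Z i j ≡ just (g i j)
    entry-defined : ∀ {i j z} → entry Z i j ≡ just z → i < s × j < s × z ≡ g i j

IsWindow : ∀ {X : Set} n → ℕ → Grid X → Matrix X n n → Set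
IsWindow n s g W = Σ ℕ λ i → Σ ℕ λ j → i + n ≤ s × j + n ≤ s × W ≡ window n n g i j

module _ {X : Set} {p q} {Z : Matrix X p q} {s} {g : Grid X} (rep : Represents Z s g) where
  open Represents rep

  window-submatrix : ∀ {n} {W : Matrix X n n} → IsWindow n s g W → IsSubmatrix W Z
  window-submatrix (i , j , i+n≤s , j+n≤s , refl) = i , j , λ a b →
    trans (entry-inside (<-≤-trans (+-monoʳ-< i (Fin.toℕ<n a)) i+n≤s)
                        (<-≤-trans (+-monoʳ-< j (Fin.toℕ<n b)) j+n≤s))
          (cong just (sym (lookup²-window g i j a b)))

  submatrix-window : ∀ {n} {W : Matrix X (suc n) (suc n)} → IsSubmatrix W Z → IsWindow (suc n) s g W
  submatrix-window {n} {W} (i , j , W⊆Z) =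
    i , j , last-fits (proj₁ corner) , last-fits (proj₁ (proj₂ corner)) ,
    matrix-ext λ a b → trans (proj₂ (proj₂ (entry-defined (W⊆Z a b)))) (sym (lookup²-window g i j a b))
    where
    corner : i + toℕ (fromℕ n) < s × j + toℕ (fromℕ n) < s ×
             lookup² W (fromℕ n) (fromℕ n) ≡ g (i + toℕ (fromℕ n)) (j + toℕ (fromℕ n))
    corner = entry-defined (W⊆Z (fromℕ n) (fromℕ n))
    last-fits : ∀ {x} → x + toℕ (fromℕ n) < s → x + suc n ≤ s
    last-fits {x} = subst (_≤ s) (trans (cong (λ l → suc (x + l)) (Fin.toℕ-fromℕ n)) (sym (+-suc x n)))

windows : ∀ {X : Set} n → ℕ → Grid X → List (Matrix X n n)
windows n s g = cartesianProductWith (window n n g) (upTo (suc (s ∸ n))) (upTo (suc (s ∸ n)))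

module _ {X : Set} {n s} {g : Grid X} (n≤s : n ≤ s) where

  private
    offset⁺ : ∀ {i} → i + n ≤ s → i < suc (s ∸ n)
    offset⁺ {i} i+n≤s = s≤s (m+n≤o⇒m≤o∸n i i+n≤s)

    offset⁻ : ∀ {i} → i < suc (s ∸ n) → i + n ≤ s
    offset⁻ {i} (s≤s i≤) = subst (i + n ≤_) (m∸n+n≡m n≤s) (+-monoˡ-≤ n i≤)

  ∈-windows⁺ : ∀ {W} → IsWindow n s g W → W ∈ windows n s g
  ∈-windows⁺ (i , j , i+n≤s , j+n≤s , refl) =
    ∈-cartesianProductWith⁺ (window n n g) (∈-upTo⁺ (offset⁺ i+n≤s)) (∈-upTo⁺ (offset⁺ j+n≤s))

  ∈-windows⁻ : ∀ {W} → W ∈ windows n s g → IsWindow n s g W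
  ∈-windows⁻ W∈ with i , j , i∈ , j∈ , refl ← ∈-cartesianProductWith⁻ (window n n g) _ _ W∈
    = i , j , offset⁻ (∈-upTo⁻ i∈) , offset⁻ (∈-upTo⁻ j∈) , refl

-- μ₁ uses each letter in one quadrant of its blocks only, and there the letter is determined by
-- its π-image; code records both.
code : 𝒜 → ℬ × Fin 2 × Fin 2
code A = b0 , 0F , 0F
code B = b1 , 0F , 0F
code C = b0 , 1F , 1F
code D = b1 , 1F , 1F
code E = b0 , 0F , 1F
code F = b1 , 0F , 1F
code G = b0 , 1F , 0F
code H = b1 , 1F , 0F
code I = b2 , 0F , 0F
code J = b3 , 0F , 0F
code K = b2 , 1F , 1F
code L = b3 , 1F , 1F
code M = b2 , 0F , 1F
code N = b3 , 0F , 1F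
code O = b2 , 1F , 0F
code P = b3 , 1F , 0F

π : 𝒜 → ℬ
π x = proj₁ (code x)

quadrant : 𝒜 → Fin 2 × Fin 2
quadrant x = proj₂ (code x)

decode : ℬ × Fin 2 × Fin 2 → 𝒜
decode (b0 , p , q) = lookup² (blk A E G C) p q
decode (b1 , p , q) = lookup² (blk B F H D) p q
decode (b2 , p , q) = lookup² (blk I M O K) p q
decode (b3 , p , q) = lookup² (blk J N P L) p q

decode-code : ∀ x → decode (code x) ≡ x
decode-code A = refl
decode-code B = refl
decode-code C = refl
decode-code D = refl
decode-code E = refl
decode-code F = refl
decode-code G = refl
decode-code H = refl
decode-code I = refl
decode-code J = refl
decode-code K = refl
decode-code L = refl
decode-code M = refl
decode-code N = refl
decode-code O = refl
decode-code P = refl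

mapᴹ-code-μ₁ : ∀ x → mapᴹ code (μ₁ x) ≡ tabulate λ p → tabulate λ q → lookup² (φ₁ x) p q , p , q
mapᴹ-code-μ₁ A = refl
mapᴹ-code-μ₁ B = refl
mapᴹ-code-μ₁ C = refl
mapᴹ-code-μ₁ D = refl
mapᴹ-code-μ₁ E = refl
mapᴹ-code-μ₁ F = refl
mapᴹ-code-μ₁ G = refl
mapᴹ-code-μ₁ H = refl
mapᴹ-code-μ₁ I = refl
mapᴹ-code-μ₁ J = refl
mapᴹ-code-μ₁ K = refl
mapᴹ-code-μ₁ L = refl
mapᴹ-code-μ₁ M = refl
mapᴹ-code-μ₁ N = refl
mapᴹ-code-μ₁ O = refl
mapᴹ-code-μ₁ P = refl

_≟ℬ_ : DecidableEquality ℬ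
b0 ≟ℬ b0 = yes refl
b0 ≟ℬ b1 = no λ ()
b0 ≟ℬ b2 = no λ ()
b0 ≟ℬ b3 = no λ ()
b1 ≟ℬ b0 = no λ ()
b1 ≟ℬ b1 = yes refl
b1 ≟ℬ b2 = no λ ()
b1 ≟ℬ b3 = no λ ()
b2 ≟ℬ b0 = no λ ()
b2 ≟ℬ b1 = no λ ()
b2 ≟ℬ b2 = yes refl
b2 ≟ℬ b3 = no λ ()
b3 ≟ℬ b0 = no λ ()
b3 ≟ℬ b1 = no λ ()
b3 ≟ℬ b2 = no λ ()
b3 ≟ℬ b3 = yes refl

_≟𝒜_ : DecidableEquality 𝒜
x ≟𝒜 y = map′ code-injective (cong code) (code x ≟code code y)
  where
  _≟code_ : DecidableEquality (ℬ × Fin 2 × Fin 2)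
  _≟code_ = Product.≡-dec _≟ℬ_ (Product.≡-dec Fin._≟_ Fin._≟_)
  code-injective : code x ≡ code y → x ≡ y
  code-injective e = trans (sym (decode-code x)) (trans (cong decode e) (decode-code y))

code-μ₁ : ∀ x p q → code (lookup² (μ₁ x) p q) ≡ (lookup² (φ₁ x) p q , p , q)
code-μ₁ x p q = begin
  code (lookup² (μ₁ x) p q)
    ≡⟨ lookup²-mapᴹ code (μ₁ x) p q ⟨
  lookup² (mapᴹ code (μ₁ x)) p q
    ≡⟨ cong (λ Z → lookup² Z p q) (mapᴹ-code-μ₁ x) ⟩
  lookup² (tabulate λ p → tabulate λ q → lookup² (φ₁ x) p q , p , q) p q
    ≡⟨ cong (λ row → lookup row q)
            (Vec.lookup∘tabulate (λ p → tabulate λ q → lookup² (φ₁ x) p q , p , q) p) ⟩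
  lookup (tabulate λ q → lookup² (φ₁ x) p q , p , q) q
    ≡⟨ Vec.lookup∘tabulate (λ q → lookup² (φ₁ x) p q , p , q) q ⟩
  (lookup² (φ₁ x) p q , p , q)
    ∎
  where open ≡-Reasoning

π-at : ℕ → Grid ℬ
π-at k i j = π (T-at k i j)

quadrant-T : ∀ k i j → quadrant (T-at (suc k) i j) ≡ (parity i , parity j)
quadrant-T k i j = cong proj₂ (code-μ₁ (T-at k ⌊ i /2⌋ ⌊ j /2⌋) (parity i) (parity j))

T-at-decode : ∀ k i j → T-at (suc k) i j ≡ decode (π-at (suc k) i j , parity i , parity j)
T-at-decode k i j = trans (sym (decode-code _)) (cong (λ c → decode (π-at (suc k) i j , c)) (quadrant-T k i j))

entry-φT : ∀ k i j → entry (φ (T k)) i j ≡ Maybe.map π (entry (T (suc k)) i j)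
entry-φT k i j rewrite entry-blockSubst φ₁ (T k) i j | entry-blockSubst μ₁ (T k) i j
  with entry (T k) ⌊ i /2⌋ ⌊ j /2⌋
... | just x = cong just (cong proj₁ (sym (code-μ₁ x (parity i) (parity j))))
... | nothing = refl

T-represents : ∀ k → Represents (T k) (side k) (T-at k)
T-represents k = record { entry-inside = entry-T k ; entry-defined = entry-T⁻ k }

φT-represents : ∀ k → Represents (φ (T k)) (side (suc k)) (π-at (suc k))
φT-represents k = record { entry-inside = inside ; entry-defined = defined }
  where
  inside : ∀ {i j} → i < side (suc k) → j < side (suc k) → entry (φ (T k)) i j ≡ just (π-at (suc k) i j)
  inside {i} {j} i< j< = trans (entry-φT k i j) (cong (Maybe.map π) (entry-T (suc k) i< j<))
  defined : ∀ {i j z} → entry (φ (T k)) i j ≡ just z →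
    i < side (suc k) × j < side (suc k) × z ≡ π-at (suc k) i j
  defined {i} {j} e rewrite entry-φT k i j with entry (T (suc k)) i j in eq | e
  ... | just y | refl with entry-T⁻ (suc k) eq
  ... | i< , j< , refl = i< , j< , refl

-- Legal blocks

-- Positions of the first occurrences of the 76 distinct 2×2 blocks of T₅.
legalPositions : Vec (ℕ × ℕ) 76
legalPositions =
  (0 , 0) ∷ (0 , 1) ∷ (0 , 2) ∷ (0 , 3) ∷ (0 , 4) ∷ (0 , 5) ∷ (0 , 6) ∷ (0 , 11) ∷
  (1 , 0) ∷ (1 , 1) ∷ (1 , 2) ∷ (1 , 3) ∷ (1 , 4) ∷ (1 , 5) ∷ (1 , 6) ∷ (1 , 11) ∷
  (2 , 0) ∷ (2 , 1) ∷ (2 , 2) ∷ (2 , 3) ∷ (2 , 4) ∷ (2 , 5) ∷ (2 , 6) ∷ (2 , 7) ∷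
  (2 , 8) ∷ (2 , 11) ∷ (2 , 12) ∷ (2 , 15) ∷ (3 , 0) ∷ (3 , 1) ∷ (3 , 2) ∷ (3 , 3) ∷
  (3 , 4) ∷ (3 , 5) ∷ (3 , 6) ∷ (3 , 7) ∷ (3 , 8) ∷ (3 , 11) ∷ (3 , 12) ∷ (3 , 15) ∷
  (4 , 0) ∷ (4 , 1) ∷ (4 , 2) ∷ (4 , 3) ∷ (4 , 4) ∷ (4 , 5) ∷ (4 , 6) ∷ (4 , 11) ∷
  (5 , 0) ∷ (5 , 1) ∷ (5 , 2) ∷ (5 , 3) ∷ (5 , 4) ∷ (5 , 5) ∷ (5 , 6) ∷ (5 , 11) ∷
  (6 , 1) ∷ (6 , 2) ∷ (6 , 3) ∷ (6 , 11) ∷ (6 , 13) ∷ (6 , 14) ∷ (7 , 1) ∷ (7 , 2) ∷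
  (7 , 3) ∷ (7 , 4) ∷ (7 , 11) ∷ (7 , 12) ∷ (7 , 13) ∷ (7 , 14) ∷ (14 , 3) ∷ (14 , 27) ∷
  (15 , 3) ∷ (15 , 4) ∷ (15 , 27) ∷ (15 , 28) ∷ []

row col : Fin 76 → ℕ
row t = proj₁ (lookup legalPositions t)
col t = proj₂ (lookup legalPositions t)

LegalAt : ℕ → ℕ → ℕ → Fin 76 → Set
LegalAt k i j t = Agree 2 2 (T-at k) i j (T-at 5) (row t) (col t)

-- Checked by evaluation; opaque keeps the type checker from unfolding the decision procedures.
opaque
  legal-in-range : ∀ t → suc (row t) < 32 × suc (col t) < 32
  legal-in-range = from-yes (Fin.all? λ t → (suc (row t) <? 32) ×-dec (suc (col t) <? 32))

  T₁-legal : Σ (Fin 76) (LegalAt 1 0 0)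
  T₁-legal = from-yes (Fin.any? λ t → agree? _≟𝒜_ 2 2 (T-at 1) 0 0 (T-at 5) (row t) (col t))

  children-legal : ∀ t {e} → e < 3 → ∀ {f} → f < 3 → Σ (Fin 76) (LegalAt 6 (row t * 2 + e) (col t * 2 + f))
  children-legal = from-yes (Fin.all? λ t → allUpTo? (λ e → allUpTo? (λ f → Fin.any? λ c →
    agree? _≟𝒜_ 2 2 (T-at 6) (row t * 2 + e) (col t * 2 + f) (T-at 5) (row c) (col c)) 3) 3)

+2≤4⇒<3 : ∀ {e} → e + 2 ≤ 4 → e < 3
+2≤4⇒<3 {e} e+2≤4 = +-cancelʳ-≤ 2 (suc e) 3 (s≤s e+2≤4)

block-legal : ∀ k {i j} → suc i < side (suc k) → suc j < side (suc k) → Σ (Fin 76) (LegalAt (suc k) i j)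
block-legal zero {0} {0} _ _ = T₁-legal
block-legal zero {suc i} (s≤s (s≤s ())) _
block-legal zero {0} {suc j} _ (s≤s (s≤s ()))
block-legal (suc k) {i} {j} i< j<
  with p , e , p< , e+2≤4 , refl ← split-index 2 (side (suc k)) (s≤s z≤n) ≤-refl (2≤side k)
                                     (subst (_≤ side (suc k) * 2) (+-comm 2 i) i<)
  with q , f , q< , f+2≤4 , refl ← split-index 2 (side (suc k)) (s≤s z≤n) ≤-refl (2≤side k)
                                     (subst (_≤ side (suc k) * 2) (+-comm 2 j) j<)
  with t , legal ← block-legal k p< q<
  with c , legalᶜ ← children-legal t (+2≤4⇒<3 e+2≤4) (+2≤4⇒<3 f+2≤4)
  = c , Agree-trans (Agree-shrink e f e+2≤4 f+2≤4 (expand-agree μ₁ legal)) legalᶜ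

-- Every window of T occurs in T_{m+5}

N-in-top-row : ∀ m → Σ ℕ λ c → c < side m × T-at m 0 c ≡ N
N-in-top-row zero = 0 , s≤s z≤n , refl
N-in-top-row (suc m) with c , c< , Tₘ[0,c]≡N ← N-in-top-row m = c * 2 + 1 , bound , (begin
  T-at (suc m) 0 (c * 2 + 1)                 ≡⟨ expand-*2+ μ₁ (T-at m) 0 c 0 1 ⟩
  lookup² (μ₁ (T-at m 0 (c + 0))) 0F 1F   ≡⟨ cong (λ z → lookup² (μ₁ (T-at m 0 z)) 0F 1F) (+-identityʳ c) ⟩
  lookup² (μ₁ (T-at m 0 c)) 0F 1F         ≡⟨ cong (λ z → lookup² (μ₁ z) 0F 1F) Tₘ[0,c]≡N ⟩
  N                                          ∎)
  where
  open ≡-Reasoning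
  bound : c * 2 + 1 < side m * 2
  bound = subst (_≤ side m * 2) (cong suc (+-comm 1 (c * 2))) (*-monoˡ-≤ 2 c<)

embed : ∀ k d → Σ ℕ λ c → c + side k ≤ side (k + d) × Agree (side k) (side k) (T-at k) 0 0 (T-at (k + d)) 0 c
embed k d with c , c< , T[0,c]≡N ← N-in-top-row d = c * side k , bound , embedded
  where
  base : Agree 1 1 (T-at 0) 0 0 (T-at d) 0 c
  base = agree N≡T[0,c+b]
    where
    N≡T[0,c+b] : ∀ {a} → a < 1 → ∀ {b} → b < 1 → N ≡ T-at d (0 + a) (c + b)
    N≡T[0,c+b] (s≤s z≤n) (s≤s z≤n) = trans (sym T[0,c]≡N) (cong (T-at d 0) (sym (+-identityʳ c)))
  embedded : Agree (side k) (side k) (T-at k) 0 0 (T-at (k + d)) 0 (c * side k)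
  embedded = subst₂ (λ h g → Agree h h (T-at k) 0 0 g 0 (c * side k))
    (+-identityʳ (side k)) (sym (expand^-+ μ₁ k d _)) (expand^-agree μ₁ k base)
  bound : c * side k + side k ≤ side (k + d)
  bound = begin
    c * side k + side k   ≡⟨ +-comm (c * side k) (side k) ⟩
    suc c * side k        ≤⟨ *-monoˡ-≤ (side k) c< ⟩
    side d * side k       ≡⟨ side-+ k d ⟨
    side (k + d)          ∎
    where open ≤-Reasoning

LegalOccurrence : ℕ → ℕ → ℕ → Grid 𝒜 → ℕ → ℕ → Set
LegalOccurrence m h w f x y = Σ (Fin 76) λ t → Σ ℕ λ r → Σ ℕ λ s →
  r + h ≤ 2 * side m × s + w ≤ 2 * side m ×
  Agree h w f x y (T-at (m + 5)) (row t * side m + r) (col t * side m + s)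

LegalOccurrence-transfer : ∀ {m h w f x y g x′ y′} → Agree h w f x y g x′ y′ →
  LegalOccurrence m h w g x′ y′ → LegalOccurrence m h w f x y
LegalOccurrence-transfer fg (t , r , s , r+h≤ , s+w≤ , g≈) = t , r , s , r+h≤ , s+w≤ , Agree-trans fg g≈

legal-occurrence-in-T[m+1+k] : ∀ m k {h w x y} → 0 < h → 0 < w → h ≤ side m → w ≤ side m →
  x + h ≤ side (m + suc k) → y + w ≤ side (m + suc k) → LegalOccurrence m h w (T-at (m + suc k)) x y
legal-occurrence-in-T[m+1+k] m k {h} {w} {x} {y} 0<h 0<w h≤ w≤ x+h≤ y+w≤
  with p , r , p< , r+h≤ , refl ← split-index (side m) (side (suc k)) 0<h h≤ (2≤side k)
                                     (subst (x + h ≤_) (side-+ m (suc k)) x+h≤)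
  with q , s , q< , s+w≤ , refl ← split-index (side m) (side (suc k)) 0<w w≤ (2≤side k)
                                     (subst (y + w ≤_) (side-+ m (suc k)) y+w≤)
  with t , legal ← block-legal k p< q<
  = t , r , s , r+h≤ , s+w≤ , Agree-shrink r s r+h≤ s+w≤ scaled
  where
  scaled : Agree (2 * side m) (2 * side m) (T-at (m + suc k)) (p * side m) (q * side m)
                 (T-at (m + 5)) (row t * side m) (col t * side m)
  scaled = subst₂ (λ f g → Agree (2 * side m) (2 * side m) f (p * side m) (q * side m)
                                  g (row t * side m) (col t * side m))
    (sym (expand^-+ μ₁ m (suc k) _)) (sym (expand^-+ μ₁ m 5 _)) (expand^-agree μ₁ m legal)

legal-occurrence : ∀ m {k h w x y} → 0 < h → 0 < w → h ≤ side m → w ≤ side m →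
  x + h ≤ side k → y + w ≤ side k → LegalOccurrence m h w (T-at k) x y
legal-occurrence m {k} {h} {w} {x} {y} 0<h 0<w h≤ w≤ x+h≤ y+w≤ with c , c+side≤ , embedded ← embed k (suc m) =
  LegalOccurrence-transfer {m}
    (Agree-shrink x y x+h≤ y+w≤ (subst (λ l → Agree (side k) (side k) (T-at k) 0 0 (T-at l) 0 c) level embedded))
    (legal-occurrence-in-T[m+1+k] m k 0<h 0<w h≤ w≤ (≤-trans x+h≤ side-k≤) y-bound)
  where
  level : k + suc m ≡ m + suc k
  level = trans (+-suc k m) (trans (cong suc (+-comm k m)) (sym (+-suc m k)))
  side-k≤ : side k ≤ side (m + suc k)
  side-k≤ = subst (side k ≤_) (cong side level) (≤-trans (m≤n+m (side k) c) c+side≤)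
  y-bound : c + y + w ≤ side (m + suc k)
  y-bound = begin
    c + y + w         ≡⟨ +-assoc c y w ⟩
    c + (y + w)       ≤⟨ +-monoʳ-≤ c y+w≤ ⟩
    c + side k        ≤⟨ c+side≤ ⟩
    side (k + suc m)  ≡⟨ cong side level ⟩
    side (m + suc k)  ∎
    where open ≤-Reasoning

legal-bound : ∀ m {p r l} → suc p < 32 → r + l ≤ 2 * side m → p * side m + r + l ≤ side (m + 5)
legal-bound m {p} {r} {l} p<31 r+l≤ = begin
  p * side m + r + l        ≡⟨ +-assoc (p * side m) r l ⟩
  p * side m + (r + l)      ≤⟨ +-monoʳ-≤ (p * side m) r+l≤ ⟩
  p * side m + 2 * side m   ≡⟨ *-distribʳ-+ (side m) p 2 ⟨
  (p + 2) * side m          ≤⟨ *-monoˡ-≤ (side m) (subst (_≤ 32) (+-comm 2 p) p<31) ⟩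
  32 * side m               ≡⟨ side-+ m 5 ⟨
  side (m + 5)              ∎
  where open ≤-Reasoning

window-in-T[n+5] : ∀ {n k} {W : Matrix 𝒜 n n} → 0 < n →
  IsWindow n (side k) (T-at k) W → IsWindow n (side (n + 5)) (T-at (n + 5)) W
window-in-T[n+5] {n} {k} 0<n (i , j , i+n≤ , j+n≤ , refl)
  with t , r , s , r+n≤ , s+n≤ , legal
         ← legal-occurrence n {k} 0<n 0<n (<⇒≤ (n<side n)) (<⇒≤ (n<side n)) i+n≤ j+n≤
  = row t * side n + r , col t * side n + s ,
    legal-bound n (proj₁ (legal-in-range t)) r+n≤ , legal-bound n (proj₂ (legal-in-range t)) s+n≤ ,
    window-cong legal

-- Recovering position parities from π-images

-- Row and column parity of the position of a 3×2 window of T, read off its π-image.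
-- The patterns caught by the last clause do not occur in T.
alignment : Matrix ℬ 3 2 → Fin 2 × Fin 2
alignment ((b0 ∷ b0 ∷ []) ∷ (b1 ∷ b2 ∷ []) ∷ (b0 ∷ b2 ∷ []) ∷ []) = 1F , 0F
alignment ((b0 ∷ b0 ∷ []) ∷ (b1 ∷ b2 ∷ []) ∷ (b1 ∷ b3 ∷ []) ∷ []) = 1F , 0F
alignment ((b0 ∷ b0 ∷ []) ∷ (b2 ∷ b3 ∷ []) ∷ (b2 ∷ b2 ∷ []) ∷ []) = 1F , 0F
alignment ((b0 ∷ b0 ∷ []) ∷ (b2 ∷ b3 ∷ []) ∷ (b3 ∷ b3 ∷ []) ∷ []) = 1F , 0F
alignment ((b0 ∷ b0 ∷ []) ∷ (b3 ∷ b2 ∷ []) ∷ (b3 ∷ b2 ∷ []) ∷ []) = 1F , 1F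
alignment ((b0 ∷ b1 ∷ []) ∷ (b0 ∷ b0 ∷ []) ∷ (b1 ∷ b2 ∷ []) ∷ []) = 0F , 0F
alignment ((b0 ∷ b1 ∷ []) ∷ (b0 ∷ b0 ∷ []) ∷ (b3 ∷ b2 ∷ []) ∷ []) = 0F , 1F
alignment ((b0 ∷ b1 ∷ []) ∷ (b0 ∷ b1 ∷ []) ∷ (b3 ∷ b0 ∷ []) ∷ []) = 0F , 1F
alignment ((b0 ∷ b1 ∷ []) ∷ (b1 ∷ b0 ∷ []) ∷ (b3 ∷ b0 ∷ []) ∷ []) = 0F , 1F
alignment ((b0 ∷ b1 ∷ []) ∷ (b1 ∷ b1 ∷ []) ∷ (b1 ∷ b2 ∷ []) ∷ []) = 0F , 0F
alignment ((b0 ∷ b1 ∷ []) ∷ (b1 ∷ b1 ∷ []) ∷ (b3 ∷ b2 ∷ []) ∷ []) = 0F , 1F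
alignment ((b0 ∷ b1 ∷ []) ∷ (b2 ∷ b1 ∷ []) ∷ (b2 ∷ b0 ∷ []) ∷ []) = 1F , 1F
alignment ((b0 ∷ b1 ∷ []) ∷ (b2 ∷ b1 ∷ []) ∷ (b3 ∷ b1 ∷ []) ∷ []) = 1F , 1F
alignment ((b0 ∷ b1 ∷ []) ∷ (b3 ∷ b0 ∷ []) ∷ (b2 ∷ b1 ∷ []) ∷ []) = 1F , 1F
alignment ((b0 ∷ b1 ∷ []) ∷ (b3 ∷ b0 ∷ []) ∷ (b3 ∷ b0 ∷ []) ∷ []) = 1F , 1F
alignment ((b0 ∷ b2 ∷ []) ∷ (b0 ∷ b1 ∷ []) ∷ (b0 ∷ b0 ∷ []) ∷ []) = 1F , 0F
alignment ((b0 ∷ b2 ∷ []) ∷ (b0 ∷ b1 ∷ []) ∷ (b1 ∷ b1 ∷ []) ∷ []) = 1F , 0F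
alignment ((b0 ∷ b2 ∷ []) ∷ (b1 ∷ b0 ∷ []) ∷ (b0 ∷ b0 ∷ []) ∷ []) = 1F , 0F
alignment ((b0 ∷ b2 ∷ []) ∷ (b1 ∷ b0 ∷ []) ∷ (b1 ∷ b1 ∷ []) ∷ []) = 1F , 0F
alignment ((b0 ∷ b2 ∷ []) ∷ (b2 ∷ b1 ∷ []) ∷ (b2 ∷ b0 ∷ []) ∷ []) = 1F , 0F
alignment ((b0 ∷ b2 ∷ []) ∷ (b3 ∷ b0 ∷ []) ∷ (b3 ∷ b0 ∷ []) ∷ []) = 1F , 1F
alignment ((b0 ∷ b3 ∷ []) ∷ (b0 ∷ b2 ∷ []) ∷ (b1 ∷ b0 ∷ []) ∷ []) = 0F , 0F
alignment ((b0 ∷ b3 ∷ []) ∷ (b0 ∷ b2 ∷ []) ∷ (b3 ∷ b0 ∷ []) ∷ []) = 0F , 1F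
alignment ((b0 ∷ b3 ∷ []) ∷ (b0 ∷ b3 ∷ []) ∷ (b3 ∷ b2 ∷ []) ∷ []) = 0F , 1F
alignment ((b0 ∷ b3 ∷ []) ∷ (b1 ∷ b2 ∷ []) ∷ (b3 ∷ b2 ∷ []) ∷ []) = 0F , 1F
alignment ((b0 ∷ b3 ∷ []) ∷ (b1 ∷ b3 ∷ []) ∷ (b1 ∷ b0 ∷ []) ∷ []) = 0F , 0F
alignment ((b0 ∷ b3 ∷ []) ∷ (b1 ∷ b3 ∷ []) ∷ (b3 ∷ b0 ∷ []) ∷ []) = 0F , 1F
alignment ((b0 ∷ b3 ∷ []) ∷ (b2 ∷ b3 ∷ []) ∷ (b2 ∷ b2 ∷ []) ∷ []) = 1F , 1F
alignment ((b0 ∷ b3 ∷ []) ∷ (b2 ∷ b3 ∷ []) ∷ (b3 ∷ b3 ∷ []) ∷ []) = 1F , 1F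
alignment ((b0 ∷ b3 ∷ []) ∷ (b3 ∷ b2 ∷ []) ∷ (b2 ∷ b3 ∷ []) ∷ []) = 1F , 1F
alignment ((b0 ∷ b3 ∷ []) ∷ (b3 ∷ b2 ∷ []) ∷ (b3 ∷ b2 ∷ []) ∷ []) = 1F , 1F
alignment ((b1 ∷ b0 ∷ []) ∷ (b0 ∷ b0 ∷ []) ∷ (b2 ∷ b3 ∷ []) ∷ []) = 0F , 0F
alignment ((b1 ∷ b0 ∷ []) ∷ (b0 ∷ b1 ∷ []) ∷ (b2 ∷ b1 ∷ []) ∷ []) = 0F , 1F
alignment ((b1 ∷ b0 ∷ []) ∷ (b1 ∷ b0 ∷ []) ∷ (b2 ∷ b1 ∷ []) ∷ []) = 0F , 1F
alignment ((b1 ∷ b0 ∷ []) ∷ (b1 ∷ b1 ∷ []) ∷ (b2 ∷ b3 ∷ []) ∷ []) = 0F , 0F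
alignment ((b1 ∷ b0 ∷ []) ∷ (b2 ∷ b1 ∷ []) ∷ (b2 ∷ b0 ∷ []) ∷ []) = 1F , 1F
alignment ((b1 ∷ b0 ∷ []) ∷ (b2 ∷ b1 ∷ []) ∷ (b3 ∷ b1 ∷ []) ∷ []) = 1F , 1F
alignment ((b1 ∷ b0 ∷ []) ∷ (b3 ∷ b0 ∷ []) ∷ (b2 ∷ b1 ∷ []) ∷ []) = 1F , 1F
alignment ((b1 ∷ b0 ∷ []) ∷ (b3 ∷ b0 ∷ []) ∷ (b3 ∷ b0 ∷ []) ∷ []) = 1F , 1F
alignment ((b1 ∷ b1 ∷ []) ∷ (b1 ∷ b2 ∷ []) ∷ (b0 ∷ b2 ∷ []) ∷ []) = 1F , 0F
alignment ((b1 ∷ b1 ∷ []) ∷ (b1 ∷ b2 ∷ []) ∷ (b1 ∷ b3 ∷ []) ∷ []) = 1F , 0F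
alignment ((b1 ∷ b1 ∷ []) ∷ (b2 ∷ b3 ∷ []) ∷ (b2 ∷ b2 ∷ []) ∷ []) = 1F , 0F
alignment ((b1 ∷ b1 ∷ []) ∷ (b2 ∷ b3 ∷ []) ∷ (b3 ∷ b3 ∷ []) ∷ []) = 1F , 0F
alignment ((b1 ∷ b1 ∷ []) ∷ (b3 ∷ b2 ∷ []) ∷ (b3 ∷ b2 ∷ []) ∷ []) = 1F , 1F
alignment ((b1 ∷ b2 ∷ []) ∷ (b0 ∷ b2 ∷ []) ∷ (b0 ∷ b1 ∷ []) ∷ []) = 0F , 0F
alignment ((b1 ∷ b2 ∷ []) ∷ (b0 ∷ b2 ∷ []) ∷ (b2 ∷ b1 ∷ []) ∷ []) = 0F , 0F
alignment ((b1 ∷ b2 ∷ []) ∷ (b0 ∷ b3 ∷ []) ∷ (b2 ∷ b3 ∷ []) ∷ []) = 0F , 1F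
alignment ((b1 ∷ b2 ∷ []) ∷ (b1 ∷ b2 ∷ []) ∷ (b2 ∷ b3 ∷ []) ∷ []) = 0F , 1F
alignment ((b1 ∷ b2 ∷ []) ∷ (b1 ∷ b3 ∷ []) ∷ (b0 ∷ b1 ∷ []) ∷ []) = 0F , 0F
alignment ((b1 ∷ b2 ∷ []) ∷ (b1 ∷ b3 ∷ []) ∷ (b2 ∷ b1 ∷ []) ∷ []) = 0F , 0F
alignment ((b1 ∷ b2 ∷ []) ∷ (b2 ∷ b3 ∷ []) ∷ (b2 ∷ b2 ∷ []) ∷ []) = 1F , 1F
alignment ((b1 ∷ b2 ∷ []) ∷ (b2 ∷ b3 ∷ []) ∷ (b3 ∷ b3 ∷ []) ∷ []) = 1F , 1F
alignment ((b1 ∷ b2 ∷ []) ∷ (b3 ∷ b2 ∷ []) ∷ (b2 ∷ b3 ∷ []) ∷ []) = 1F , 1F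
alignment ((b1 ∷ b2 ∷ []) ∷ (b3 ∷ b2 ∷ []) ∷ (b3 ∷ b2 ∷ []) ∷ []) = 1F , 1F
alignment ((b1 ∷ b3 ∷ []) ∷ (b0 ∷ b1 ∷ []) ∷ (b0 ∷ b0 ∷ []) ∷ []) = 1F , 0F
alignment ((b1 ∷ b3 ∷ []) ∷ (b0 ∷ b1 ∷ []) ∷ (b1 ∷ b1 ∷ []) ∷ []) = 1F , 0F
alignment ((b1 ∷ b3 ∷ []) ∷ (b1 ∷ b0 ∷ []) ∷ (b0 ∷ b0 ∷ []) ∷ []) = 1F , 0F
alignment ((b1 ∷ b3 ∷ []) ∷ (b1 ∷ b0 ∷ []) ∷ (b1 ∷ b1 ∷ []) ∷ []) = 1F , 0F
alignment ((b1 ∷ b3 ∷ []) ∷ (b2 ∷ b1 ∷ []) ∷ (b2 ∷ b0 ∷ []) ∷ []) = 1F , 0F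
alignment ((b1 ∷ b3 ∷ []) ∷ (b3 ∷ b0 ∷ []) ∷ (b3 ∷ b0 ∷ []) ∷ []) = 1F , 1F
alignment ((b2 ∷ b0 ∷ []) ∷ (b0 ∷ b3 ∷ []) ∷ (b0 ∷ b2 ∷ []) ∷ []) = 1F , 0F
alignment ((b2 ∷ b0 ∷ []) ∷ (b0 ∷ b3 ∷ []) ∷ (b1 ∷ b3 ∷ []) ∷ []) = 1F , 0F
alignment ((b2 ∷ b0 ∷ []) ∷ (b1 ∷ b2 ∷ []) ∷ (b0 ∷ b3 ∷ []) ∷ []) = 1F , 1F
alignment ((b2 ∷ b0 ∷ []) ∷ (b1 ∷ b2 ∷ []) ∷ (b1 ∷ b2 ∷ []) ∷ []) = 1F , 1F
alignment ((b2 ∷ b0 ∷ []) ∷ (b3 ∷ b2 ∷ []) ∷ (b2 ∷ b2 ∷ []) ∷ []) = 1F , 0F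
alignment ((b2 ∷ b0 ∷ []) ∷ (b3 ∷ b2 ∷ []) ∷ (b3 ∷ b3 ∷ []) ∷ []) = 1F , 0F
alignment ((b2 ∷ b1 ∷ []) ∷ (b0 ∷ b1 ∷ []) ∷ (b0 ∷ b0 ∷ []) ∷ []) = 1F , 1F
alignment ((b2 ∷ b1 ∷ []) ∷ (b0 ∷ b1 ∷ []) ∷ (b0 ∷ b1 ∷ []) ∷ []) = 1F , 1F
alignment ((b2 ∷ b1 ∷ []) ∷ (b0 ∷ b1 ∷ []) ∷ (b1 ∷ b0 ∷ []) ∷ []) = 1F , 1F
alignment ((b2 ∷ b1 ∷ []) ∷ (b0 ∷ b1 ∷ []) ∷ (b1 ∷ b1 ∷ []) ∷ []) = 1F , 1F
alignment ((b2 ∷ b1 ∷ []) ∷ (b2 ∷ b0 ∷ []) ∷ (b1 ∷ b2 ∷ []) ∷ []) = 0F , 1F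
alignment ((b2 ∷ b1 ∷ []) ∷ (b2 ∷ b0 ∷ []) ∷ (b3 ∷ b2 ∷ []) ∷ []) = 0F , 0F
alignment ((b2 ∷ b1 ∷ []) ∷ (b3 ∷ b1 ∷ []) ∷ (b1 ∷ b2 ∷ []) ∷ []) = 0F , 1F
alignment ((b2 ∷ b1 ∷ []) ∷ (b3 ∷ b1 ∷ []) ∷ (b3 ∷ b2 ∷ []) ∷ []) = 0F , 0F
alignment ((b2 ∷ b2 ∷ []) ∷ (b0 ∷ b1 ∷ []) ∷ (b0 ∷ b0 ∷ []) ∷ []) = 1F , 0F
alignment ((b2 ∷ b2 ∷ []) ∷ (b1 ∷ b0 ∷ []) ∷ (b0 ∷ b1 ∷ []) ∷ []) = 1F , 1F
alignment ((b2 ∷ b2 ∷ []) ∷ (b1 ∷ b0 ∷ []) ∷ (b1 ∷ b0 ∷ []) ∷ []) = 1F , 1F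
alignment ((b2 ∷ b2 ∷ []) ∷ (b2 ∷ b1 ∷ []) ∷ (b2 ∷ b0 ∷ []) ∷ []) = 1F , 0F
alignment ((b2 ∷ b2 ∷ []) ∷ (b2 ∷ b1 ∷ []) ∷ (b3 ∷ b1 ∷ []) ∷ []) = 1F , 0F
alignment ((b2 ∷ b2 ∷ []) ∷ (b3 ∷ b0 ∷ []) ∷ (b2 ∷ b0 ∷ []) ∷ []) = 1F , 0F
alignment ((b2 ∷ b2 ∷ []) ∷ (b3 ∷ b0 ∷ []) ∷ (b3 ∷ b1 ∷ []) ∷ []) = 1F , 0F
alignment ((b2 ∷ b3 ∷ []) ∷ (b0 ∷ b3 ∷ []) ∷ (b0 ∷ b2 ∷ []) ∷ []) = 1F , 1F
alignment ((b2 ∷ b3 ∷ []) ∷ (b0 ∷ b3 ∷ []) ∷ (b0 ∷ b3 ∷ []) ∷ []) = 1F , 1F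
alignment ((b2 ∷ b3 ∷ []) ∷ (b0 ∷ b3 ∷ []) ∷ (b1 ∷ b2 ∷ []) ∷ []) = 1F , 1F
alignment ((b2 ∷ b3 ∷ []) ∷ (b0 ∷ b3 ∷ []) ∷ (b1 ∷ b3 ∷ []) ∷ []) = 1F , 1F
alignment ((b2 ∷ b3 ∷ []) ∷ (b2 ∷ b2 ∷ []) ∷ (b1 ∷ b0 ∷ []) ∷ []) = 0F , 1F
alignment ((b2 ∷ b3 ∷ []) ∷ (b2 ∷ b2 ∷ []) ∷ (b3 ∷ b0 ∷ []) ∷ []) = 0F , 0F
alignment ((b2 ∷ b3 ∷ []) ∷ (b3 ∷ b3 ∷ []) ∷ (b1 ∷ b0 ∷ []) ∷ []) = 0F , 1F
alignment ((b2 ∷ b3 ∷ []) ∷ (b3 ∷ b3 ∷ []) ∷ (b3 ∷ b0 ∷ []) ∷ []) = 0F , 0F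
alignment ((b3 ∷ b0 ∷ []) ∷ (b0 ∷ b1 ∷ []) ∷ (b0 ∷ b1 ∷ []) ∷ []) = 1F , 1F
alignment ((b3 ∷ b0 ∷ []) ∷ (b0 ∷ b1 ∷ []) ∷ (b1 ∷ b0 ∷ []) ∷ []) = 1F , 1F
alignment ((b3 ∷ b0 ∷ []) ∷ (b2 ∷ b0 ∷ []) ∷ (b0 ∷ b3 ∷ []) ∷ []) = 0F , 0F
alignment ((b3 ∷ b0 ∷ []) ∷ (b2 ∷ b1 ∷ []) ∷ (b0 ∷ b1 ∷ []) ∷ []) = 0F , 1F
alignment ((b3 ∷ b0 ∷ []) ∷ (b3 ∷ b0 ∷ []) ∷ (b0 ∷ b1 ∷ []) ∷ []) = 0F , 1F
alignment ((b3 ∷ b0 ∷ []) ∷ (b3 ∷ b1 ∷ []) ∷ (b0 ∷ b3 ∷ []) ∷ []) = 0F , 0F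
alignment ((b3 ∷ b1 ∷ []) ∷ (b0 ∷ b3 ∷ []) ∷ (b0 ∷ b2 ∷ []) ∷ []) = 1F , 0F
alignment ((b3 ∷ b1 ∷ []) ∷ (b0 ∷ b3 ∷ []) ∷ (b1 ∷ b3 ∷ []) ∷ []) = 1F , 0F
alignment ((b3 ∷ b1 ∷ []) ∷ (b1 ∷ b2 ∷ []) ∷ (b0 ∷ b3 ∷ []) ∷ []) = 1F , 1F
alignment ((b3 ∷ b1 ∷ []) ∷ (b1 ∷ b2 ∷ []) ∷ (b1 ∷ b2 ∷ []) ∷ []) = 1F , 1F
alignment ((b3 ∷ b1 ∷ []) ∷ (b3 ∷ b2 ∷ []) ∷ (b2 ∷ b2 ∷ []) ∷ []) = 1F , 0F
alignment ((b3 ∷ b1 ∷ []) ∷ (b3 ∷ b2 ∷ []) ∷ (b3 ∷ b3 ∷ []) ∷ []) = 1F , 0F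
alignment ((b3 ∷ b2 ∷ []) ∷ (b0 ∷ b3 ∷ []) ∷ (b0 ∷ b3 ∷ []) ∷ []) = 1F , 1F
alignment ((b3 ∷ b2 ∷ []) ∷ (b0 ∷ b3 ∷ []) ∷ (b1 ∷ b2 ∷ []) ∷ []) = 1F , 1F
alignment ((b3 ∷ b2 ∷ []) ∷ (b2 ∷ b2 ∷ []) ∷ (b0 ∷ b1 ∷ []) ∷ []) = 0F , 0F
alignment ((b3 ∷ b2 ∷ []) ∷ (b2 ∷ b2 ∷ []) ∷ (b2 ∷ b1 ∷ []) ∷ []) = 0F , 0F
alignment ((b3 ∷ b2 ∷ []) ∷ (b2 ∷ b3 ∷ []) ∷ (b0 ∷ b3 ∷ []) ∷ []) = 0F , 1F
alignment ((b3 ∷ b2 ∷ []) ∷ (b3 ∷ b2 ∷ []) ∷ (b0 ∷ b3 ∷ []) ∷ []) = 0F , 1F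
alignment ((b3 ∷ b2 ∷ []) ∷ (b3 ∷ b3 ∷ []) ∷ (b0 ∷ b1 ∷ []) ∷ []) = 0F , 0F
alignment ((b3 ∷ b2 ∷ []) ∷ (b3 ∷ b3 ∷ []) ∷ (b2 ∷ b1 ∷ []) ∷ []) = 0F , 0F
alignment ((b3 ∷ b3 ∷ []) ∷ (b0 ∷ b1 ∷ []) ∷ (b0 ∷ b0 ∷ []) ∷ []) = 1F , 0F
alignment ((b3 ∷ b3 ∷ []) ∷ (b1 ∷ b0 ∷ []) ∷ (b0 ∷ b1 ∷ []) ∷ []) = 1F , 1F
alignment ((b3 ∷ b3 ∷ []) ∷ (b1 ∷ b0 ∷ []) ∷ (b1 ∷ b0 ∷ []) ∷ []) = 1F , 1F
alignment ((b3 ∷ b3 ∷ []) ∷ (b2 ∷ b1 ∷ []) ∷ (b2 ∷ b0 ∷ []) ∷ []) = 1F , 0F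
alignment ((b3 ∷ b3 ∷ []) ∷ (b2 ∷ b1 ∷ []) ∷ (b3 ∷ b1 ∷ []) ∷ []) = 1F , 0F
alignment ((b3 ∷ b3 ∷ []) ∷ (b3 ∷ b0 ∷ []) ∷ (b2 ∷ b0 ∷ []) ∷ []) = 1F , 0F
alignment ((b3 ∷ b3 ∷ []) ∷ (b3 ∷ b0 ∷ []) ∷ (b3 ∷ b1 ∷ []) ∷ []) = 1F , 0F
alignment _ = 0F , 0F

opaque
  alignment-certificate : ∀ t {r} → r < 6 → ∀ {s} → s < 7 →
    alignment (window 3 2 (π-at 7) (row t * 4 + r) (col t * 4 + s)) ≡ quadrant (T-at 7 (row t * 4 + r) (col t * 4 + s))
  alignment-certificate = from-yes (Fin.all? λ t → allUpTo? (λ r → allUpTo? (λ s →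
    Product.≡-dec Fin._≟_ Fin._≟_
      (alignment (window 3 2 (π-at 7) (row t * 4 + r) (col t * 4 + s)))
      (quadrant (T-at 7 (row t * 4 + r) (col t * 4 + s)))) 7) 6)

alignment-correct : ∀ {k x y} → x + 3 ≤ side k → y + 2 ≤ side k →
  alignment (window 3 2 (π-at k) x y) ≡ quadrant (T-at k x y)
alignment-correct {k} {x} {y} x+3≤ y+2≤
  with t , r , s , r+3≤8 , s+2≤8 , legal
         ← legal-occurrence 2 {k} (s≤s z≤n) (s≤s z≤n) (s≤s (s≤s (s≤s z≤n))) (s≤s (s≤s z≤n)) x+3≤ y+2≤
  = begin
  alignment (window 3 2 (π-at k) x y)
    ≡⟨ cong alignment (window-cong (Agree-map π legal)) ⟩
  alignment (window 3 2 (π-at 7) (row t * 4 + r) (col t * 4 + s))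
    ≡⟨ alignment-certificate t (+-cancelʳ-≤ 3 (suc r) 6 (s≤s r+3≤8))
                               (+-cancelʳ-≤ 2 (suc s) 7 (s≤s s+2≤8)) ⟩
  quadrant (T-at 7 (row t * 4 + r) (col t * 4 + s))
    ≡⟨ cong quadrant (Agree-corner (s≤s z≤n) (s≤s z≤n) legal) ⟨
  quadrant (T-at k x y)
    ∎
  where open ≡-Reasoning

π-injective-on-windows : ∀ {n k k′} {W W′ : Matrix 𝒜 n n} → 3 ≤ n →
  IsWindow n (side (suc k)) (T-at (suc k)) W → IsWindow n (side (suc k′)) (T-at (suc k′)) W′ →
  mapᴹ π W ≡ mapᴹ π W′ → W ≡ W′
π-injective-on-windows {n} {k} {k′} 3≤n
  (i , j , i+n≤ , j+n≤ , refl) (i′ , j′ , i′+n≤ , j′+n≤ , refl) πW≡πW′ =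
  window-cong same-letters
  where
  open ≡-Reasoning
  2≤n : 2 ≤ n
  2≤n = ≤-trans (s≤s (s≤s z≤n)) 3≤n
  same-π : Agree n n (π-at (suc k)) i j (π-at (suc k′)) i′ j′
  same-π = window-agree (begin
    window n n (π-at (suc k)) i j              ≡⟨ mapᴹ-window π (T-at (suc k)) i j ⟨
    mapᴹ π (window n n (T-at (suc k)) i j)     ≡⟨ πW≡πW′ ⟩
    mapᴹ π (window n n (T-at (suc k′)) i′ j′)  ≡⟨ mapᴹ-window π (T-at (suc k′)) i′ j′ ⟩
    window n n (π-at (suc k′)) i′ j′           ∎)
  same-parities : (parity i , parity j) ≡ (parity i′ , parity j′)
  same-parities = begin
    (parity i , parity j)
      ≡⟨ quadrant-T k i j ⟨
    quadrant (T-at (suc k) i j)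
      ≡⟨ alignment-correct {suc k} (≤-trans (+-monoʳ-≤ i 3≤n) i+n≤)
                                   (≤-trans (+-monoʳ-≤ j 2≤n) j+n≤) ⟨
    alignment (window 3 2 (π-at (suc k)) i j)
      ≡⟨ cong alignment (window-cong (Agree-restrict 3≤n 2≤n same-π)) ⟩
    alignment (window 3 2 (π-at (suc k′)) i′ j′)
      ≡⟨ alignment-correct {suc k′} (≤-trans (+-monoʳ-≤ i′ 3≤n) i′+n≤)
                                    (≤-trans (+-monoʳ-≤ j′ 2≤n) j′+n≤) ⟩
    quadrant (T-at (suc k′) i′ j′)
      ≡⟨ quadrant-T k′ i′ j′ ⟩
    (parity i′ , parity j′)
      ∎
  same-letters : Agree n n (T-at (suc k)) i j (T-at (suc k′)) i′ j′
  same-letters = agree λ {a} a< {b} b< → begin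
    T-at (suc k) (i + a) (j + b)
      ≡⟨ T-at-decode k (i + a) (j + b) ⟩
    decode (π-at (suc k) (i + a) (j + b) , parity (i + a) , parity (j + b))
      ≡⟨ cong₂ (λ c pq → decode (c , pq)) (at same-π a< b<)
               (cong₂ _,_ (parity-cong-+ {i} {i′} (cong proj₁ same-parities) a)
                          (parity-cong-+ {j} {j′} (cong proj₂ same-parities) b)) ⟩
    decode (π-at (suc k′) (i′ + a) (j′ + b) , parity (i′ + a) , parity (j′ + b))
      ≡⟨ T-at-decode k′ (i′ + a) (j′ + b) ⟨
    T-at (suc k′) (i′ + a) (j′ + b)
      ∎

-- Counting

unique-map⁺-on : ∀ {X Y : Set} {f : X → Y} {xs} → (∀ {x y} → x ∈ xs → y ∈ xs → f x ≡ f y → x ≡ y) →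
  Unique xs → Unique (List.map f xs)
unique-map⁺-on inj [] = []
unique-map⁺-on inj (x≢xs ∷ xs!) =
  All.map⁺ (All.tabulate λ y∈ fx≡fy → All.lookup x≢xs y∈ (inj (here refl) (there y∈) fx≡fy))
  ∷ unique-map⁺-on (λ x∈ y∈ → inj (there x∈) (there y∈)) xs!

_≟ᴹ_ : ∀ {n} → DecidableEquality (Matrix 𝒜 n n)
_≟ᴹ_ = Vec.≡-dec (Vec.≡-dec _≟𝒜_)

n≤side[n+5] : ∀ n → n ≤ side (n + 5)
n≤side[n+5] n = ≤-trans (<⇒≤ (n<side n)) (subst (side n ≤_) (sym (side-+ n 5)) (m≤n*m (side n) 32))

windowsT : ∀ n → List (Matrix 𝒜 n n)
windowsT n = deduplicate _≟ᴹ_ (windows n (side (n + 5)) (T-at (n + 5)))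

windowsT-unique : ∀ n → Unique (windowsT n)
windowsT-unique n = deduplicate-! _≟ᴹ_ (windows n (side (n + 5)) (T-at (n + 5)))

∈-windowsT⁻ : ∀ {n W} → W ∈ windowsT n → IsWindow n (side (n + 5)) (T-at (n + 5)) W
∈-windowsT⁻ {n} W∈ =
  ∈-windows⁻ {g = T-at (n + 5)} (n≤side[n+5] n)
    (∈-deduplicate⁻ _≟ᴹ_ (windows n (side (n + 5)) (T-at (n + 5))) W∈)

∈windowsT⇔InPT : ∀ n (W : Matrix 𝒜 (suc n) (suc n)) → W ∈ windowsT (suc n) ⇔ InPT W
∈windowsT⇔InPT n W = mk⇔
  (λ W∈ → suc n + 5 , window-submatrix (T-represents (suc n + 5)) (∈-windowsT⁻ W∈))
  (λ (k , W⊆Tk) → ∈-deduplicate⁺ _≟ᴹ_ (∈-windows⁺ {g = T-at (suc n + 5)} (n≤side[n+5] (suc n))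
                     (window-in-T[n+5] {k = k} (s≤s z≤n) (submatrix-window (T-represents k) {W = W} W⊆Tk))))

π-window-submatrix : ∀ {n k} {W : Matrix 𝒜 n n} →
  IsWindow n (side (suc k)) (T-at (suc k)) W → IsSubmatrix (mapᴹ π W) (φ (T k))
π-window-submatrix {k = k} (i , j , i+n≤ , j+n≤ , W≡) =
  window-submatrix (φT-represents k)
    (i , j , i+n≤ , j+n≤ , trans (cong (mapᴹ π) W≡) (mapᴹ-window π (T-at (suc k)) i j))

∈windowsS⇔InPS : ∀ n (V : Matrix ℬ (suc n) (suc n)) → V ∈ List.map (mapᴹ π) (windowsT (suc n)) ⇔ InPS V
∈windowsS⇔InPS n V = mk⇔ from to
  where
  to : InPS V → V ∈ List.map (mapᴹ π) (windowsT (suc n))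
  to (k , V⊆φTk) with i , j , i+n≤ , j+n≤ , V≡ ← submatrix-window (φT-represents k) {W = V} V⊆φTk =
    subst (_∈ List.map (mapᴹ π) (windowsT (suc n))) (trans (mapᴹ-window π (T-at (suc k)) i j) (sym V≡))
      (∈-map⁺ (mapᴹ π) (Equivalence.from (∈windowsT⇔InPT n (window (suc n) (suc n) (T-at (suc k)) i j))
        (suc k , window-submatrix (T-represents (suc k)) (i , j , i+n≤ , j+n≤ , refl))))
  from : ∀ {V} → V ∈ List.map (mapᴹ π) (windowsT (suc n)) → InPS V
  from V∈ with W , W∈ , refl ← ∈-map⁻ (mapᴹ π) V∈ = n + 5 , π-window-submatrix {k = n + 5} (∈-windowsT⁻ W∈)

theorem2 : (n : ℕ) → 3 ≤ n →
    Σ ℕ (λ c → HasSize (InPT {n} {n}) c × HasSize (InPS {n} {n}) c)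
theorem2 (suc n) 3≤n = length (windowsT (suc n)) , sizeT , sizeS
  where
  sizeT : HasSize (InPT {suc n} {suc n}) (length (windowsT (suc n)))
  sizeT = windowsT (suc n) , windowsT-unique (suc n) , refl , ∈windowsT⇔InPT n
  sizeS : HasSize (InPS {suc n} {suc n}) (length (windowsT (suc n)))
  sizeS = List.map (mapᴹ π) (windowsT (suc n)) ,
          unique-map⁺-on (λ W∈ W′∈ → π-injective-on-windows {k = n + 5} {k′ = n + 5} 3≤n
                                         (∈-windowsT⁻ W∈) (∈-windowsT⁻ W′∈))
                         (windowsT-unique (suc n)) ,
          length-map (mapᴹ π) (windowsT (suc n)) ,
          ∈windowsS⇔InPS n
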